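{- Let $r,s,t$ be positive integers with $1 \leq t \leq r \leq s$, and let \[n_0(r,s,t) = \max\left\{r(s-t) {r+s-t \choose t}, \, (r-t){r \choose t} {r+s-t \choose t+1}\right\} + t+1.\] Let $n \geq n_0(r,s,t)$. If $\mathcal{A} \subseteq {[n] \choose r}$ and $\mathcal{B} \subseteq {[n] \choose s}$ are cross-$t$-intersecting, then \[|\mathcal{A}||\mathcal{B}| \leq {n-t \choose r-t}{n-t \choose s-t},\] and equality holds if and only if for some $T \in {[n] \choose t}$, $\mathcal{A} = \{A \in {[n] \choose r} \colon T \subseteq A\}$ and $\mathcal{B} = \{B \in {[n] \choose s} \colon T \subseteq B\}$.
   Context: $[n] = \{1,\dots,n\}$ and ${X \choose r}$ denotes the family of all $r$-element subsets of $X$. Families $\mathcal{A}$ and $\mathcal{B}$ are cross-$t$-intersecting if $|A \cap B| \geq t$ for every $A \in \mathcal{A}$ and every $B \in \mathcal{B}$. The families $\mathcal{A},\mathcal{B}$ may be empty. -}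

module Defs where

open import Data.Nat using (ℕ; zero; suc; _+_; _*_; _∸_; _≤_; _≥_; _⊔_)
open import Data.Nat.Combinatorics using (_C_)
open import Data.Bool using (Bool; true; false; if_then_else_)
open import Data.List using (List; []; _∷_; map; _++_; length; filter)
open import Data.Vec using (_∷_; [])
open import Data.Fin.Subset using (Subset; Side; inside; outside; ∣_∣; _⊆_; _∩_)
open import Relation.Binary.PropositionalEquality using (_≡_)
open import Relation.Nullary.Decidable using (⌊_⌋)
open import Data.Fin.Subset.Properties using (_⊆?_)

Family : ℕ → Set
Family n = Subset n → Bool

allSubsets : (n : ℕ) → List (Subset n)
allSubsets zero = [] ∷ []
allSubsets (suc n) = map (inside ∷_) (allSubsets n) ++ map (outside ∷_) (allSubsets n)

card : {n : ℕ} → Family n → ℕ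
card {n} 𝒜 = length (filter (λ X → 𝒜 X Data.Bool.≟ true) (allSubsets n))
  where import Data.Bool

IsUniform : {n : ℕ} → ℕ → Family n → Set
IsUniform r 𝒜 = ∀ X → 𝒜 X ≡ true → ∣ X ∣ ≡ r

CrossIntersecting : {n : ℕ} → ℕ → Family n → Family n → Set
CrossIntersecting t 𝒜 ℬ = ∀ A B → 𝒜 A ≡ true → ℬ B ≡ true → t ≤ ∣ A ∩ B ∣

star : {n : ℕ} → ℕ → Subset n → Family n
star r T X = (∣ X ∣ Data.Nat.≡ᵇ r) Data.Bool.∧ ⌊ T ⊆? X ⌋
  where import Data.Nat ; import Data.Bool

_≐_ : {n : ℕ} → Family n → Family n → Set
𝒜 ≐ ℬ = ∀ X → 𝒜 X ≡ ℬ X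

n₀ : ℕ → ℕ → ℕ → ℕ
n₀ r s t = ((r * (s ∸ t)) * ((r + s ∸ t) C t)
             ⊔ ((r ∸ t) * (r C t)) * ((r + s ∸ t) C (t + 1))) + t + 1

-- If some t-set T lies in every member of 𝒜 and of ℬ, both families sit inside the stars of T,
-- which gives the bound, with equality only for the full stars. Otherwise put N = n − t. Given
-- A ∈ 𝒜, every member of ℬ meets A in at least t points, so ℬ is covered by the C(r,t) stars of
-- the t-subsets of A, each of size at most C(N, s−t). If a t-set S is not contained in some
-- B ∈ ℬ, every member of 𝒜 containing S also contains a point of B outside S, so at most
-- s·C(N−1, r−t−1) = s·(r−t)·C(N, r−t)/N members of 𝒜 contain S. According to whether 𝒜 or ℬ
-- has a t-set lying in all of its members, these estimates give |𝒜||ℬ| < C(N, r−t)·C(N, s−t)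
-- once N exceeds both (r−t)·C(r,t)·s and (s−t)·C(s,t)·r, which n ≥ n₀ guarantees.

module Submission where

open import Defs
open import Data.Nat
open import Data.Nat.Properties
open import Data.Nat.Combinatorics using (_C_; nC1≡n; nCk+nC[k+1]≡[n+1]C[k+1])
open import Data.Nat.Combinatorics.Specification using (k>n⇒nCk≡0)
open import Data.Nat.Solver using (module +-*-Solver)
open import Data.Bool using (Bool; true; false; _∧_; not)
open import Data.Bool.Properties using (∧-identityʳ; T-≡)
import Data.Bool as Bool
open import Data.List using (List; []; _∷_; _++_; map; length; filter)
open import Data.List.Properties using (length-++; filter-++)
open import Data.List.Membership.Propositional using (_∈_)
open import Data.List.Membership.Propositional.Properties using (∈-++⁺ˡ; ∈-++⁺ʳ; ∈-map⁺)
open import Data.List.Relation.Unary.Any using (here; there)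
open import Data.Empty using (⊥-elim)
open import Data.Product using (_×_; _,_; ∃-syntax; proj₁)
open import Data.Sum using (_⊎_; inj₁; inj₂)
open import Data.Vec using ([]; _∷_; here)
open import Data.Fin.Subset using (Subset; inside; outside; ∣_∣; _⊆_; _∩_; _∪_; _─_; ⊤; ∁)
  renaming (⊥ to ∅; _∈_ to _∈ₛ_)
open import Data.Fin.Subset.Properties
  using ( _⊆?_; ⊆-refl; ⊆-trans; drop-∷-⊆; out⊆; s⊆s; ⊆⊤; ⊥⊆; p⊆q⇒∣p∣≤∣q∣; ∣∁p∣≡n∸∣p∣; ∣⊥∣≡0; p─⊥≡p
        ; p∩q⊆p; p∩q⊆q; x∈p∩q⁺; x∈p∩q⁻; p⊆p∪q; q⊆p∪q; ∩-comm; anySubset?)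
open import Function using (_∘_; case_of_)
open import Function.Bundles using (Equivalence; _⇔_; mk⇔)
open import Relation.Nullary.Decidable
  using (Dec; yes; no; does; dec-true; isYes≗does; _×-dec_; ¬?; decidable-stable)
open import Relation.Nullary using (¬_)
open import Relation.Binary.PropositionalEquality

open +-*-Solver using (solve; _:=_; _:+_; _:*_; con)

private variable
  A B : Set
  d j k m n : ℕ

-- Binomial coefficients

-- d C[ k − j ] is d choose (k − j) for an honest difference: it vanishes when k < j.
_C[_−_] : ℕ → ℕ → ℕ → ℕ
d C[ k     − zero  ] = d C k
d C[ zero  − suc j ] = 0
d C[ suc k − suc j ] = d C[ k − j ]

C[−]≡C∸ : j ≤ k → d C[ k − j ] ≡ d C (k ∸ j)
C[−]≡C∸ {zero}          _         = refl
C[−]≡C∸ {suc j} {suc k} (s≤s j≤k) = C[−]≡C∸ j≤k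

C[1+j−j]≡d : ∀ d j → d C[ suc j − j ] ≡ d
C[1+j−j]≡d d zero    = nC1≡n d
C[1+j−j]≡d d (suc j) = C[1+j−j]≡d d j

C[−]-pascal₀ : ∀ d j → suc d C[ 0 − j ] ≡ d C[ 0 − j ]
C[−]-pascal₀ d zero    = refl
C[−]-pascal₀ d (suc j) = refl

C[−]-pascal : ∀ d k j → suc d C[ suc k − j ] ≡ d C[ k − j ] + d C[ suc k − j ]
C[−]-pascal d k       zero    = sym (nCk+nC[k+1]≡[n+1]C[k+1] d k)
C[−]-pascal d zero    (suc j) = C[−]-pascal₀ d j
C[−]-pascal d (suc k) (suc j) = C[−]-pascal d k j

C-absorb : ∀ d k → suc k * (suc d C suc k) ≡ suc d * (d C k)
C-absorb zero    zero    = refl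
C-absorb zero    (suc k) =
  trans (cong (suc (suc k) *_) (k>n⇒nCk≡0 {1} {suc (suc k)} (s≤s (s≤s z≤n)))) (*-zeroʳ (suc (suc k)))
C-absorb (suc d) zero    = begin
  1 * (suc (suc d) C 1) ≡⟨ *-identityˡ _ ⟩
  suc (suc d) C 1       ≡⟨ nC1≡n (suc (suc d)) ⟩
  suc (suc d)           ≡⟨ *-identityʳ _ ⟨
  suc (suc d) * 1       ∎
  where open ≡-Reasoning
C-absorb (suc d) (suc k) = begin
  suc (suc k) * (suc (suc d) C suc (suc k))
    ≡⟨ cong (suc (suc k) *_) (nCk+nC[k+1]≡[n+1]C[k+1] (suc d) (suc k)) ⟨
  suc (suc k) * (x + y)
    ≡⟨ solve 3 (λ k x y → (con 2 :+ k) :* (x :+ y) := x :+ ((con 1 :+ k) :* x :+ (con 2 :+ k) :* y)) refl k x y ⟩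
  x + (suc k * x + suc (suc k) * y)
    ≡⟨ cong (x +_) (cong₂ _+_ (C-absorb d k) (C-absorb d (suc k))) ⟩
  x + (suc d * (d C k) + suc d * (d C suc k))
    ≡⟨ cong (x +_) (*-distribˡ-+ (suc d) (d C k) (d C suc k)) ⟨
  x + suc d * (d C k + d C suc k)
    ≡⟨ cong (λ z → x + suc d * z) (nCk+nC[k+1]≡[n+1]C[k+1] d k) ⟩
  x + suc d * x
    ∎
  where
  open ≡-Reasoning
  x y : ℕ
  x = suc d C suc k
  y = suc d C suc (suc k)

C[−]-absorb : ∀ d k j → (k ∸ j) * (suc d C[ k − j ]) ≡ suc d * (d C[ k − suc j ])
C[−]-absorb d zero    zero    = sym (*-zeroʳ (suc d))
C[−]-absorb d (suc k) zero    = C-absorb d k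
C[−]-absorb d zero    (suc j) = sym (*-zeroʳ (suc d))
C[−]-absorb d (suc k) (suc j) = C[−]-absorb d k j

k≤n⇒0<nCk : k ≤ m → 0 < m C k
k≤n⇒0<nCk {zero}          _         = s≤s z≤n
k≤n⇒0<nCk {suc k} {suc m} (s≤s k≤m) =
  subst (0 <_) (nCk+nC[k+1]≡[n+1]C[k+1] m k) (≤-trans (k≤n⇒0<nCk k≤m) (m≤m+n _ _))

nCk≤[1+n]Ck : ∀ m k → m C k ≤ suc m C k
nCk≤[1+n]Ck m       zero    = ≤-refl
nCk≤[1+n]Ck m       (suc k) = subst (m C suc k ≤_) (nCk+nC[k+1]≡[n+1]C[k+1] m k) (m≤n+m _ _)

C-monoˡ-≤ : ∀ k → m ≤ d → m C k ≤ d C k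
C-monoˡ-≤ k m≤d = go (≤⇒≤′ m≤d)
  where
  go : ∀ {d} → m ≤′ d → m C k ≤ d C k
  go ≤′-refl        = ≤-refl
  go (≤′-step m≤′d) = ≤-trans (go m≤′d) (nCk≤[1+n]Ck _ k)

n≤nCk : 1 ≤ k → k < m → m ≤ m C k
n≤nCk {suc zero}    {suc m} _ _ = ≤-reflexive (sym (nC1≡n (suc m)))
n≤nCk {suc (suc k)} {suc m} _ (s≤s k<m) =
  subst (suc m ≤_) (nCk+nC[k+1]≡[n+1]C[k+1] m (suc k))
    (subst (_≤ m C suc k + m C suc (suc k)) (+-comm m 1)
      (+-mono-≤ (n≤nCk (s≤s z≤n) k<m) (k≤n⇒0<nCk k<m)))

C[−]-absorb-∸ : ∀ {n t} k → t < n → t ≤ k →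
  (n ∸ t) * (n ∸ suc t) C[ k − suc t ] ≡ (k ∸ t) * ((n ∸ t) C (k ∸ t))
C[−]-absorb-∸ {n} {t} k t<n t≤k = begin
  (n ∸ t) * (n ∸ suc t) C[ k − suc t ]      ≡⟨ cong (_* (n ∸ suc t) C[ k − suc t ]) 1+[n∸1+t]≡n∸t ⟨
  suc (n ∸ suc t) * (n ∸ suc t) C[ k − suc t ] ≡⟨ C[−]-absorb (n ∸ suc t) k t ⟨
  (k ∸ t) * suc (n ∸ suc t) C[ k − t ]      ≡⟨ cong (λ N → (k ∸ t) * N C[ k − t ]) 1+[n∸1+t]≡n∸t ⟩
  (k ∸ t) * (n ∸ t) C[ k − t ]              ≡⟨ cong ((k ∸ t) *_) (C[−]≡C∸ t≤k) ⟩
  (k ∸ t) * ((n ∸ t) C (k ∸ t))             ∎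
  where
  open ≡-Reasoning
  1+[n∸1+t]≡n∸t : suc (n ∸ suc t) ≡ n ∸ t
  1+[n∸1+t]≡n∸t = sym (+-∸-assoc 1 t<n)

scaled<⇒< : ∀ {N x y P} → N * x ≤ y * P → y < N → 0 < P → x < P
scaled<⇒< {N} {x} {y} {P@(suc _)} N*x≤y*P y<N _ = *-cancelˡ-< N x P (≤-<-trans N*x≤y*P (*-monoˡ-< P y<N))

*-≡-tight : ∀ {a b P Q} → a ≤ P → b ≤ Q → 0 < P → 0 < Q → a * b ≡ P * Q → a ≡ P × b ≡ Q
*-≡-tight {a} {b} {P} {Q@(suc _)} a≤P b≤Q 0<P _ ab≡PQ with a <? P
... | yes a<P = ⊥-elim (<-irrefl ab≡PQ (≤-<-trans (*-monoʳ-≤ a b≤Q) (*-monoˡ-< Q a<P)))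
... | no  a≮P = a≡P , *-cancelˡ-≡ b Q P {{>-nonZero 0<P}} (trans (cong (_* b) (sym a≡P)) ab≡PQ)
  where
  a≡P : a ≡ P
  a≡P = ≤-antisym a≤P (≮⇒≥ a≮P)

-- `card F` unfolds to `countᵇ F (allSubsets n)`.
countᵇ : (A → Bool) → List A → ℕ
countᵇ p xs = length (filter (λ x → p x Bool.≟ true) xs)

countᵇ-++ : ∀ (p : A → Bool) xs ys → countᵇ p (xs ++ ys) ≡ countᵇ p xs + countᵇ p ys
countᵇ-++ p xs ys = trans (cong length (filter-++ (λ x → p x Bool.≟ true) xs ys)) (length-++ (filter _ xs))

countᵇ-map : ∀ (p : A → Bool) (f : B → A) xs → countᵇ p (map f xs) ≡ countᵇ (p ∘ f) xs
countᵇ-map p f []       = refl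
countᵇ-map p f (x ∷ xs) with p (f x)
... | true  = cong suc (countᵇ-map p f xs)
... | false = countᵇ-map p f xs

countᵇ-mono : {p q : A → Bool} → (∀ x → p x ≡ true → q x ≡ true) → ∀ xs → countᵇ p xs ≤ countᵇ q xs
countᵇ-mono p⇒q []       = z≤n
countᵇ-mono {p = p} {q} p⇒q (x ∷ xs) with p x in px | q x in qx
... | true  | true  = s≤s (countᵇ-mono p⇒q xs)
... | true  | false = case trans (sym (p⇒q x px)) qx of λ ()
... | false | true  = m≤n⇒m≤1+n (countᵇ-mono p⇒q xs)
... | false | false = countᵇ-mono p⇒q xs

countᵇ-none : {p : A → Bool} → (∀ x → p x ≢ true) → ∀ xs → countᵇ p xs ≡ 0
countᵇ-none ¬p []       = refl
countᵇ-none {p = p} ¬p (x ∷ xs) with p x in px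
... | true  = ⊥-elim (¬p x px)
... | false = countᵇ-none ¬p xs

countᵇ-split : ∀ (p q : A → Bool) xs → countᵇ p xs ≤ countᵇ q xs + countᵇ (λ x → p x ∧ not (q x)) xs
countᵇ-split p q []       = z≤n
countᵇ-split p q (x ∷ xs) with p x | q x
... | true  | true  = s≤s (countᵇ-split p q xs)
... | true  | false = ≤-trans (s≤s (countᵇ-split p q xs)) (≤-reflexive (sym (+-suc _ _)))
... | false | true  = m≤n⇒m≤1+n (countᵇ-split p q xs)
... | false | false = countᵇ-split p q xs

countᵇ-strict : {p q : A → Bool} {x : A} {xs : List A} → (∀ y → p y ≡ true → q y ≡ true) →
  x ∈ xs → q x ≡ true → p x ≢ true → countᵇ p xs < countᵇ q xs
countᵇ-strict {p = p} {q} {x} {x ∷ xs} p⇒q (here refl) qx ¬px with p x in px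
... | true  = ⊥-elim (¬px refl)
... | false rewrite qx = s≤s (countᵇ-mono p⇒q xs)
countᵇ-strict {p = p} {q} {x} {y ∷ xs} p⇒q (there x∈xs) qx ¬px with p y in py | q y in qy
... | true  | true  = s≤s (countᵇ-strict p⇒q x∈xs qx ¬px)
... | true  | false = case trans (sym (p⇒q y py)) qy of λ ()
... | false | true  = m≤n⇒m≤1+n (countᵇ-strict p⇒q x∈xs qx ¬px)
... | false | false = countᵇ-strict p⇒q x∈xs qx ¬px

countᵇ-cover : {A B : Set} {c : ℕ} {p : B → Bool} (I : A → Bool) (q : A → B → Bool) (ys : List B) →
  (∀ a → I a ≡ true → countᵇ (q a) ys ≤ c) → (as : List A) →
  (∀ y → p y ≡ true → ∃[ a ] a ∈ as × I a ≡ true × q a y ≡ true) →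
  countᵇ p ys ≤ countᵇ I as * c
countᵇ-cover I q ys qa≤c [] covered =
  ≤-reflexive (countᵇ-none (λ y py → case covered y py of λ { (_ , () , _) }) ys)
countᵇ-cover {B = B} {c = c} {p} I q ys qa≤c (a ∷ as) covered with I a in Ia
... | true  = begin
  countᵇ p ys                               ≤⟨ countᵇ-split p (q a) ys ⟩
  countᵇ (q a) ys + countᵇ rest ys          ≤⟨ +-mono-≤ (qa≤c a Ia) (countᵇ-cover I q ys qa≤c as rest-covered) ⟩
  c + countᵇ I as * c                       ∎
  where
  open ≤-Reasoning
  rest : B → Bool
  rest y = p y ∧ not (q a y)
  rest-covered : ∀ y → rest y ≡ true → ∃[ a′ ] a′ ∈ as × I a′ ≡ true × q a′ y ≡ true
  rest-covered y resty with p y in py | q a y in qay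
  rest-covered y () | true | true
  rest-covered y _  | true | false with covered y py
  ... | a′ , there a′∈as , Ia′ , qa′y = a′ , a′∈as , Ia′ , qa′y
  ... | _  , here refl   , _   , qay′ = case trans (sym qay′) qay of λ ()
... | false = countᵇ-cover I q ys qa≤c as λ y py → case covered y py of λ where
  (a′ , there a′∈as , Ia′ , qa′y) → a′ , a′∈as , Ia′ , qa′y
  (_  , here refl   , Ia′ , _)    → case trans (sym Ia′) Ia of λ ()

_⊆ᶠ_ : Family n → Family n → Set
F ⊆ᶠ G = ∀ X → F X ≡ true → G X ≡ true

∈-allSubsets : (X : Subset n) → X ∈ allSubsets n
∈-allSubsets []            = here refl
∈-allSubsets (inside  ∷ X) = ∈-++⁺ˡ (∈-map⁺ (inside ∷_) (∈-allSubsets X))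
∈-allSubsets (outside ∷ X) = ∈-++⁺ʳ (map (inside ∷_) (allSubsets _)) (∈-map⁺ (outside ∷_) (∈-allSubsets X))

card-∷ : (F : Family (suc n)) → card F ≡ card (F ∘ (inside ∷_)) + card (F ∘ (outside ∷_))
card-∷ {n} F = begin
  countᵇ F (map (inside ∷_) (allSubsets n) ++ map (outside ∷_) (allSubsets n))
    ≡⟨ countᵇ-++ F (map (inside ∷_) (allSubsets n)) _ ⟩
  countᵇ F (map (inside ∷_) (allSubsets n)) + countᵇ F (map (outside ∷_) (allSubsets n))
    ≡⟨ cong₂ _+_ (countᵇ-map F (inside ∷_) (allSubsets n)) (countᵇ-map F (outside ∷_) (allSubsets n)) ⟩
  card (F ∘ (inside ∷_)) + card (F ∘ (outside ∷_))
    ∎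
  where open ≡-Reasoning

card-mono : {F G : Family n} → F ⊆ᶠ G → card F ≤ card G
card-mono {n} F⊆G = countᵇ-mono F⊆G (allSubsets n)

card-cong : {F G : Family n} → F ≐ G → card F ≡ card G
card-cong F≐G = ≤-antisym (card-mono (λ X FX → trans (sym (F≐G X)) FX)) (card-mono (λ X GX → trans (F≐G X) GX))

card-∅ : (F : Family n) → (∀ X → F X ≢ true) → card F ≡ 0
card-∅ {n} F F∅ = countᵇ-none F∅ (allSubsets n)

card-≡⇒≐ : {F G : Family n} → F ⊆ᶠ G → card F ≡ card G → F ≐ G
card-≡⇒≐ {F = F} {G} F⊆G ∣F∣≡∣G∣ X with F X in FX | G X in GX
... | true  | true  = refl
... | false | false = refl
... | true  | false = trans (sym (F⊆G X FX)) GX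
... | false | true  =
  ⊥-elim (<-irrefl ∣F∣≡∣G∣ (countᵇ-strict F⊆G (∈-allSubsets X) GX (λ FX′ → case trans (sym FX′) FX of λ ())))

card-cover : {F : Family n} {c : ℕ} (I : Family n) (q : Subset n → Family n) →
  (∀ S → I S ≡ true → card (q S) ≤ c) → (∀ X → F X ≡ true → ∃[ S ] I S ≡ true × q S X ≡ true) →
  card F ≤ card I * c
card-cover {n} I q q≤c covered =
  countᵇ-cover I q (allSubsets n) q≤c (allSubsets n)
    (λ X FX → let S , IS , qSX = covered X FX in S , ∈-allSubsets S , IS , qSX)

card-∷-inside : (F : Family (suc n)) → (∀ X → F (outside ∷ X) ≢ true) → card F ≡ card (F ∘ (inside ∷_))
card-∷-inside F none =
  trans (card-∷ F) (trans (cong (card (F ∘ (inside ∷_)) +_) (card-∅ (F ∘ (outside ∷_)) none)) (+-identityʳ _))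

card-∷-outside : (F : Family (suc n)) → (∀ X → F (inside ∷ X) ≢ true) → card F ≡ card (F ∘ (outside ∷_))
card-∷-outside F none = trans (card-∷ F) (cong (_+ card (F ∘ (outside ∷_))) (card-∅ (F ∘ (inside ∷_)) none))

does-true⇒ : (a? : Dec A) → does a? ≡ true → A
does-true⇒ (yes a) _ = a

∧-≢trueʳ : ∀ a {b} → b ≢ true → a ∧ b ≢ true
∧-≢trueʳ true  b≢true = b≢true
∧-≢trueʳ false _      = λ ()

∧-true⁻ : ∀ {a b} → a ∧ b ≡ true → a ≡ true × b ≡ true
∧-true⁻ {true} {true} _ = refl , refl

∧-true⁺ : ∀ {a b} → a ≡ true → b ≡ true → a ∧ b ≡ true
∧-true⁺ refl refl = refl

≡ᵇ-true⇒≡ : ∀ {m n} → (m ≡ᵇ n) ≡ true → m ≡ n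
≡ᵇ-true⇒≡ {m} {n} e = ≡ᵇ⇒≡ m n (Equivalence.from T-≡ e)

≡⇒≡ᵇ-true : ∀ {m n} → m ≡ n → (m ≡ᵇ n) ≡ true
≡⇒≡ᵇ-true {m} {n} e = Equivalence.to T-≡ (≡⇒≡ᵇ m n e)

p⊆q∧∣q∣≤∣p∣⇒p≡q : {p q : Subset n} → p ⊆ q → ∣ q ∣ ≤ ∣ p ∣ → p ≡ q
p⊆q∧∣q∣≤∣p∣⇒p≡q {p = []}          {[]}          _   _ = refl
p⊆q∧∣q∣≤∣p∣⇒p≡q {p = outside ∷ p} {outside ∷ q} p⊆q ∣q∣≤∣p∣ =
  cong (outside ∷_) (p⊆q∧∣q∣≤∣p∣⇒p≡q (drop-∷-⊆ p⊆q) ∣q∣≤∣p∣)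
p⊆q∧∣q∣≤∣p∣⇒p≡q {p = inside  ∷ p} {inside  ∷ q} p⊆q (s≤s ∣q∣≤∣p∣) =
  cong (inside ∷_) (p⊆q∧∣q∣≤∣p∣⇒p≡q (drop-∷-⊆ p⊆q) ∣q∣≤∣p∣)
p⊆q∧∣q∣≤∣p∣⇒p≡q {p = outside ∷ p} {inside  ∷ q} p⊆q ∣q∣<∣p∣ =
  ⊥-elim (<⇒≱ ∣q∣<∣p∣ (p⊆q⇒∣p∣≤∣q∣ (drop-∷-⊆ p⊆q)))
p⊆q∧∣q∣≤∣p∣⇒p≡q {p = inside  ∷ p} {outside ∷ q} p⊆q _ = case p⊆q here of λ ()

⊆-interpolate : ∀ {S W : Subset n} k → S ⊆ W → ∣ S ∣ ≤ k → k ≤ ∣ W ∣ → ∃[ Y ] S ⊆ Y × Y ⊆ W × ∣ Y ∣ ≡ k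
⊆-interpolate {S = []}          {[]}          zero    _   _         _ = [] , ⊆-refl , ⊆-refl , refl
⊆-interpolate {S = inside  ∷ S} {inside  ∷ W} (suc k) S⊆W (s≤s ∣S∣≤k) (s≤s k≤∣W∣) =
  let Y , S⊆Y , Y⊆W , ∣Y∣≡k = ⊆-interpolate k (drop-∷-⊆ S⊆W) ∣S∣≤k k≤∣W∣
  in inside ∷ Y , s⊆s S⊆Y , s⊆s Y⊆W , cong suc ∣Y∣≡k
⊆-interpolate {S = inside  ∷ S} {outside ∷ W} k S⊆W _ _ = case S⊆W here of λ ()
⊆-interpolate {S = outside ∷ S} {outside ∷ W} k S⊆W ∣S∣≤k k≤∣W∣ =
  let Y , S⊆Y , Y⊆W , ∣Y∣≡k = ⊆-interpolate k (drop-∷-⊆ S⊆W) ∣S∣≤k k≤∣W∣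
  in outside ∷ Y , out⊆ S⊆Y , out⊆ Y⊆W , ∣Y∣≡k
⊆-interpolate {S = outside ∷ S} {inside  ∷ W} k S⊆W ∣S∣≤k k≤1+∣W∣ with k ≤? ∣ W ∣
... | yes k≤∣W∣ =
  let Y , S⊆Y , Y⊆W , ∣Y∣≡k = ⊆-interpolate k (drop-∷-⊆ S⊆W) ∣S∣≤k k≤∣W∣
  in outside ∷ Y , out⊆ S⊆Y , out⊆ Y⊆W , ∣Y∣≡k
... | no  k≰∣W∣ = inside ∷ W , S⊆W , ⊆-refl , ≤-antisym (≰⇒> k≰∣W∣) k≤1+∣W∣

⊤─p≡∁p : (p : Subset n) → ⊤ ─ p ≡ ∁ p
⊤─p≡∁p []            = refl
⊤─p≡∁p (inside  ∷ p) = cong (outside ∷_) (⊤─p≡∁p p)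
⊤─p≡∁p (outside ∷ p) = cong (inside ∷_) (⊤─p≡∁p p)

∣p∪q─p∣≤∣q∣ : (p q : Subset n) → ∣ p ∪ q ─ p ∣ ≤ ∣ q ∣
∣p∪q─p∣≤∣q∣ []            []            = z≤n
∣p∪q─p∣≤∣q∣ (inside  ∷ p) (inside  ∷ q) = m≤n⇒m≤1+n (∣p∪q─p∣≤∣q∣ p q)
∣p∪q─p∣≤∣q∣ (inside  ∷ p) (outside ∷ q) = ∣p∪q─p∣≤∣q∣ p q
∣p∪q─p∣≤∣q∣ (outside ∷ p) (inside  ∷ q) = s≤s (∣p∪q─p∣≤∣q∣ p q)
∣p∪q─p∣≤∣q∣ (outside ∷ p) (outside ∷ q) = ∣p∪q─p∣≤∣q∣ p q

-- Intervals and stars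

-- `does` rather than `⌊_⌋`, so that the tests reduce on `inside ∷ _` and `outside ∷ _`.
between : ℕ → Subset n → Subset n → Family n
between k S U X = (∣ X ∣ ≡ᵇ k) ∧ does (S ⊆? X) ∧ does (X ⊆? U)

card-between : ∀ k (S U : Subset n) → S ⊆ U → card (between k S U) ≡ ∣ U ─ S ∣ C[ k − ∣ S ∣ ]
card-between zero    []            []            _   = refl
card-between (suc k) []            []            _   = refl
card-between zero    (inside  ∷ S) (inside  ∷ U) _   = card-∅ (between zero (inside ∷ S) (inside ∷ U)) λ where
  (inside  ∷ X) ()
  (outside ∷ X) → ∧-≢trueʳ (∣ X ∣ ≡ᵇ 0) λ ()
card-between (suc k) (inside  ∷ S) (inside  ∷ U) S⊆U =
  trans (card-∷-inside (between (suc k) (inside ∷ S) (inside ∷ U)) λ X → ∧-≢trueʳ (∣ X ∣ ≡ᵇ suc k) λ ())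
    (card-between k S U (drop-∷-⊆ S⊆U))
card-between zero    (outside ∷ S) (inside  ∷ U) S⊆U =
  trans (card-∷-outside (between zero (outside ∷ S) (inside ∷ U)) λ _ ())
    (trans (card-between zero S U (drop-∷-⊆ S⊆U)) (sym (C[−]-pascal₀ _ ∣ S ∣)))
card-between (suc k) (outside ∷ S) (inside  ∷ U) S⊆U =
  trans (card-∷ (between (suc k) (outside ∷ S) (inside ∷ U)))
  (trans (cong₂ _+_ (card-between k S U (drop-∷-⊆ S⊆U)) (card-between (suc k) S U (drop-∷-⊆ S⊆U)))
    (sym (C[−]-pascal _ k ∣ S ∣)))
card-between k       (outside ∷ S) (outside ∷ U) S⊆U =
  trans (card-∷-outside (between k (outside ∷ S) (outside ∷ U))
           λ X → ∧-≢trueʳ (suc ∣ X ∣ ≡ᵇ k) (∧-≢trueʳ (does (S ⊆? X)) λ ()))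
    (card-between k S U (drop-∷-⊆ S⊆U))
card-between k       (inside  ∷ S) (outside ∷ U) S⊆U = case S⊆U here of λ ()

star≐between : ∀ k (T : Subset n) → star k T ≐ between k T ⊤
star≐between k T X rewrite isYes≗does (T ⊆? X) | dec-true (X ⊆? ⊤) ⊆⊤ =
  cong ((∣ X ∣ ≡ᵇ k) ∧_) (sym (∧-identityʳ _))

card-star : ∀ k (T : Subset n) → card (star k T) ≡ (n ∸ ∣ T ∣) C[ k − ∣ T ∣ ]
card-star {n} k T = begin
  card (star k T)            ≡⟨ card-cong (star≐between k T) ⟩
  card (between k T ⊤)       ≡⟨ card-between k T ⊤ ⊆⊤ ⟩
  ∣ ⊤ ─ T ∣ C[ k − ∣ T ∣ ]   ≡⟨ cong (λ d → d C[ k − ∣ T ∣ ]) (trans (cong ∣_∣ (⊤─p≡∁p T)) (∣∁p∣≡n∸∣p∣ T)) ⟩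
  (n ∸ ∣ T ∣) C[ k − ∣ T ∣ ] ∎
  where open ≡-Reasoning

card-star≡ : ∀ {n t} k (T : Subset n) → ∣ T ∣ ≡ t → t ≤ k → card (star k T) ≡ (n ∸ t) C (k ∸ t)
card-star≡ k T refl t≤k = trans (card-star k T) (C[−]≡C∸ t≤k)

∈star⁺ : {T X : Subset n} → ∣ X ∣ ≡ k → T ⊆ X → star k T X ≡ true
∈star⁺ {T = T} {X} ∣X∣≡k T⊆X = ∧-true⁺ (≡⇒≡ᵇ-true ∣X∣≡k) (trans (isYes≗does (T ⊆? X)) (dec-true (T ⊆? X) T⊆X))

∈between⁺ : {S U X : Subset n} → ∣ X ∣ ≡ k → S ⊆ X → X ⊆ U → between k S U X ≡ true
∈between⁺ {S = S} {U} {X} ∣X∣≡k S⊆X X⊆U =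
  ∧-true⁺ (≡⇒≡ᵇ-true ∣X∣≡k) (∧-true⁺ (dec-true (S ⊆? X) S⊆X) (dec-true (X ⊆? U) X⊆U))

∈between⁻ : {S U X : Subset n} → between k S U X ≡ true → ∣ X ∣ ≡ k
∈between⁻ = ≡ᵇ-true⇒≡ ∘ proj₁ ∘ ∧-true⁻

-- Bounds for uniform families

containing : Subset n → Family n → Family n
containing S F X = F X ∧ does (S ⊆? X)

∈containing⁺ : {F : Family n} {S X : Subset n} → F X ≡ true → S ⊆ X → containing S F X ≡ true
∈containing⁺ {S = S} {X} FX S⊆X = ∧-true⁺ FX (dec-true (S ⊆? X) S⊆X)

∈containing⁻ : {F : Family n} {S X : Subset n} → containing S F X ≡ true → F X ≡ true × S ⊆ X
∈containing⁻ {S = S} {X} e = let FX , S⊆?X = ∧-true⁻ e in FX , does-true⇒ (S ⊆? X) S⊆?X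

Meets : ℕ → Subset n → Family n → Set
Meets j G F = ∀ X → F X ≡ true → j ≤ ∣ X ∩ G ∣

card-containing≤ : {F : Family n} → IsUniform k F → (S : Subset n) → ∣ S ∣ ≡ j → j ≤ k →
  card (containing S F) ≤ (n ∸ j) C (k ∸ j)
card-containing≤ {n = n} {k = k} {j = j} {F = F} uniform S ∣S∣≡j j≤k = begin
  card (containing S F)   ≤⟨ card-mono containing⊆star ⟩
  card (star k S)         ≡⟨ card-star≡ k S ∣S∣≡j j≤k ⟩
  (n ∸ j) C (k ∸ j)       ∎
  where
  open ≤-Reasoning
  containing⊆star : containing S F ⊆ᶠ star k S
  containing⊆star X e = let FX , S⊆X = ∈containing⁻ {F = F} {S} e in ∈star⁺ (uniform X FX) S⊆X

card≤transversal : {F : Family n} {c : ℕ} (G : Subset n) → Meets j G F →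
  (∀ S → ∣ S ∣ ≡ j → card (containing S F) ≤ c) → card F ≤ (∣ G ∣ C j) * c
card≤transversal {n} {j} {F} {c} G meets containing≤c = begin
  card F                    ≤⟨ card-cover (between j ∅ G) (λ S → containing S F) containing≤c′ covered ⟩
  card (between j ∅ G) * c  ≡⟨ cong (_* c) (card-between j ∅ G ⊥⊆) ⟩
  ∣ G ─ ∅ ∣ C[ j − ∣ ∅ {n} ∣ ] * c ≡⟨ cong₂ (λ g z → g C[ j − z ] * c) (cong ∣_∣ (p─⊥≡p G)) (∣⊥∣≡0 n) ⟩
  (∣ G ∣ C j) * c           ∎
  where
  open ≤-Reasoning
  containing≤c′ : ∀ S → between j ∅ G S ≡ true → card (containing S F) ≤ c
  containing≤c′ S e = containing≤c S (∈between⁻ {S = ∅} {G} {S} e)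
  covered : ∀ X → F X ≡ true → ∃[ S ] between j ∅ G S ≡ true × containing S F X ≡ true
  covered X FX =
    let S , _ , S⊆X∩G , ∣S∣≡j = ⊆-interpolate j ⊥⊆ (subst (_≤ j) (sym (∣⊥∣≡0 n)) z≤n) (meets X FX)
    in S , ∈between⁺ ∣S∣≡j ⊥⊆ (⊆-trans S⊆X∩G (p∩q⊆q X G)) , ∈containing⁺ {F = F} FX (⊆-trans S⊆X∩G (p∩q⊆p X G))

-- A member X ⊇ S meets S ∪ G in more than S: otherwise X ∩ G ⊆ S, and ∣ S ∣ ≤ ∣ X ∩ G ∣ forces
-- S = X ∩ G ⊆ G. So X lies in the star of some (∣ S ∣ + 1)-set between S and S ∪ G.
card-containing≤-⊈ : {F : Family n} {G S : Subset n} → IsUniform k F → Meets j G F → ∣ S ∣ ≡ j → ¬ S ⊆ G →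
  card (containing S F) ≤ ∣ G ∣ * (n ∸ suc j) C[ k − suc j ]
card-containing≤-⊈ {n} {k} {F = F} {G} {S} uniform meets refl S⊈G = begin
  card (containing S F)  ≤⟨ card-cover I (star k) star≤c covered ⟩
  card I * c             ≤⟨ *-monoˡ-≤ c card-I≤∣G∣ ⟩
  ∣ G ∣ * c              ∎
  where
  open ≤-Reasoning
  U : Subset n
  U = S ∪ G
  I : Family n
  I = between (suc ∣ S ∣) S U
  c : ℕ
  c = (n ∸ suc ∣ S ∣) C[ k − suc ∣ S ∣ ]

  card-I≤∣G∣ : card I ≤ ∣ G ∣
  card-I≤∣G∣ = begin
    card I                           ≡⟨ card-between (suc ∣ S ∣) S U (p⊆p∪q G) ⟩
    ∣ U ─ S ∣ C[ suc ∣ S ∣ − ∣ S ∣ ] ≡⟨ C[1+j−j]≡d ∣ U ─ S ∣ ∣ S ∣ ⟩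
    ∣ U ─ S ∣                        ≤⟨ ∣p∪q─p∣≤∣q∣ S G ⟩
    ∣ G ∣                            ∎

  star≤c : ∀ Y → I Y ≡ true → card (star k Y) ≤ c
  star≤c Y e =
    ≤-reflexive (trans (card-star k Y) (cong (λ y → (n ∸ y) C[ k − y ]) (∈between⁻ {S = S} {U} {Y} e)))

  S⊆X∩U : {X : Subset n} → S ⊆ X → S ⊆ X ∩ U
  S⊆X∩U S⊆X x∈S = x∈p∩q⁺ (S⊆X x∈S , p⊆p∪q G x∈S)

  covered : ∀ X → containing S F X ≡ true → ∃[ Y ] I Y ≡ true × star k Y X ≡ true
  covered X e with FX , S⊆X ← ∈containing⁻ {F = F} {S} e | suc ∣ S ∣ ≤? ∣ X ∩ U ∣
  ... | yes ∣S∣<∣X∩U∣ =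
    let Y , S⊆Y , Y⊆X∩U , ∣Y∣≡1+∣S∣ = ⊆-interpolate (suc ∣ S ∣) (S⊆X∩U S⊆X) (n≤1+n _) ∣S∣<∣X∩U∣
    in Y , ∈between⁺ ∣Y∣≡1+∣S∣ S⊆Y (⊆-trans Y⊆X∩U (p∩q⊆q X U))
         , ∈star⁺ (uniform X FX) (⊆-trans Y⊆X∩U (p∩q⊆p X U))
  ... | no  ∣S∣≮∣X∩U∣ = ⊥-elim (S⊈G S⊆G)
    where
    S≡X∩U : S ≡ X ∩ U
    S≡X∩U = p⊆q∧∣q∣≤∣p∣⇒p≡q (S⊆X∩U S⊆X) (≤-pred (≰⇒> ∣S∣≮∣X∩U∣))
    X∩G⊆S : X ∩ G ⊆ S
    X∩G⊆S x∈X∩G = let x∈X , x∈G = x∈p∩q⁻ X G x∈X∩G in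
      subst (λ W → _ ∈ₛ W) (sym S≡X∩U) (x∈p∩q⁺ (x∈X , q⊆p∪q S G x∈G))
    S⊆G : S ⊆ G
    S⊆G = subst (_⊆ G) (p⊆q∧∣q∣≤∣p∣⇒p≡q X∩G⊆S (meets X FX)) (p∩q⊆q X G)

-- Kernels and cross-intersecting families

Kernel : Subset n → Family n → Set
Kernel T F = ∀ X → F X ≡ true → T ⊆ X

kernel⊎escape : (T : Subset n) (F : Family n) → Kernel T F ⊎ ∃[ X ] F X ≡ true × ¬ T ⊆ X
kernel⊎escape T F with anySubset? (λ X → (F X Bool.≟ true) ×-dec ¬? (T ⊆? X))
... | yes escape    = inj₂ escape
... | no  no-escape = inj₁ λ X FX → decidable-stable (T ⊆? X) λ T⊈X → no-escape (X , FX , T⊈X)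

kernel? : (T : Subset n) (F : Family n) → Dec (Kernel T F)
kernel? T F with kernel⊎escape T F
... | inj₁ kernel           = yes kernel
... | inj₂ (X , FX , T⊈X) = no λ kernel → T⊈X (kernel X FX)

kernel⇒⊆star : {F : Family n} {T : Subset n} → IsUniform k F → Kernel T F → F ⊆ᶠ star k T
kernel⇒⊆star uniform kernel X FX = ∈star⁺ (uniform X FX) (kernel X FX)

kernel⇒≐containing : {F : Family n} {T : Subset n} → Kernel T F → F ≐ containing T F
kernel⇒≐containing {F = F} {T} kernel X with F X in FX
... | false = refl
... | true  = sym (dec-true (T ⊆? X) (kernel X FX))

CrossIntersecting-sym : {𝒜 ℬ : Family n} → CrossIntersecting j 𝒜 ℬ → CrossIntersecting j ℬ 𝒜
CrossIntersecting-sym cross B A ℬB 𝒜A = subst (_ ≤_) (cong ∣_∣ (∩-comm A B)) (cross A B 𝒜A ℬB)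

card≤star : {F : Family n} {T : Subset n} → IsUniform k F → Kernel T F → ∣ T ∣ ≡ j → j ≤ k →
  card F ≤ (n ∸ j) C (k ∸ j)
card≤star {k = k} {T = T} uniform kernel ∣T∣≡j j≤k =
  subst (_ ≤_) (card-star≡ k T ∣T∣≡j j≤k) (card-mono (kernel⇒⊆star uniform kernel))

card≡⇒≐star : {F : Family n} {T : Subset n} → IsUniform k F → Kernel T F → ∣ T ∣ ≡ j → j ≤ k →
  card F ≡ (n ∸ j) C (k ∸ j) → F ≐ star k T
card≡⇒≐star {k = k} {T = T} uniform kernel ∣T∣≡j j≤k card≡ =
  card-≡⇒≐ (kernel⇒⊆star uniform kernel) (trans card≡ (sym (card-star≡ k T ∣T∣≡j j≤k)))

common-kernel⇒card≤ : ∀ {n r s t} {𝒜 ℬ : Family n} {T : Subset n} → IsUniform r 𝒜 → IsUniform s ℬ →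
  ∣ T ∣ ≡ t → t ≤ r → t ≤ s → Kernel T 𝒜 → Kernel T ℬ →
  card 𝒜 * card ℬ ≤ ((n ∸ t) C (r ∸ t)) * ((n ∸ t) C (s ∸ t))
common-kernel⇒card≤ 𝒜-uniform ℬ-uniform ∣T∣≡t t≤r t≤s kernel-𝒜 kernel-ℬ =
  *-mono-≤ (card≤star 𝒜-uniform kernel-𝒜 ∣T∣≡t t≤r) (card≤star ℬ-uniform kernel-ℬ ∣T∣≡t t≤s)

common-kernel∧card≡⇒≐stars : ∀ {n r s t} {𝒜 ℬ : Family n} {T : Subset n} → IsUniform r 𝒜 → IsUniform s ℬ →
  ∣ T ∣ ≡ t → t ≤ r → t ≤ s → Kernel T 𝒜 → Kernel T ℬ → 0 < (n ∸ t) C (r ∸ t) → 0 < (n ∸ t) C (s ∸ t) →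
  card 𝒜 * card ℬ ≡ ((n ∸ t) C (r ∸ t)) * ((n ∸ t) C (s ∸ t)) → 𝒜 ≐ star r T × ℬ ≐ star s T
common-kernel∧card≡⇒≐stars 𝒜-uniform ℬ-uniform ∣T∣≡t t≤r t≤s kernel-𝒜 kernel-ℬ 0<Pᵣ 0<Pₛ card≡ =
  let card-𝒜≡ , card-ℬ≡ = *-≡-tight (card≤star 𝒜-uniform kernel-𝒜 ∣T∣≡t t≤r)
                                     (card≤star ℬ-uniform kernel-ℬ ∣T∣≡t t≤s) 0<Pᵣ 0<Pₛ card≡
  in card≡⇒≐star 𝒜-uniform kernel-𝒜 ∣T∣≡t t≤r card-𝒜≡ , card≡⇒≐star ℬ-uniform kernel-ℬ ∣T∣≡t t≤s card-ℬ≡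

module _ {n r s t} {𝒜 ℬ : Family n}
         (𝒜-uniform : IsUniform r 𝒜) (ℬ-uniform : IsUniform s ℬ) (cross : CrossIntersecting t 𝒜 ℬ) where

  card-containing≤-¬kernel : (S : Subset n) → ∣ S ∣ ≡ t → ¬ Kernel S ℬ →
    card (containing S 𝒜) ≤ s * (n ∸ suc t) C[ r − suc t ]
  card-containing≤-¬kernel S ∣S∣≡t ¬kernel with kernel⊎escape S ℬ
  ... | inj₁ kernel            = ⊥-elim (¬kernel kernel)
  ... | inj₂ (B , ℬB , S⊈B) = subst (λ b → card (containing S 𝒜) ≤ b * _) (ℬ-uniform B ℬB)
    (card-containing≤-⊈ 𝒜-uniform (λ A 𝒜A → cross A B 𝒜A ℬB) ∣S∣≡t S⊈B)

  card≤transversal-member : {B : Subset n} {c : ℕ} → ℬ B ≡ true →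
    (∀ S → ∣ S ∣ ≡ t → card (containing S 𝒜) ≤ c) → card 𝒜 ≤ (s C t) * c
  card≤transversal-member {B} {c} ℬB containing≤c =
    subst (λ b → card 𝒜 ≤ (b C t) * c) (ℬ-uniform B ℬB)
      (card≤transversal B (λ A 𝒜A → cross A B 𝒜A ℬB) containing≤c)


module _ {n r s t} {𝒜 ℬ : Family n}
         (𝒜-uniform : IsUniform r 𝒜) (ℬ-uniform : IsUniform s ℬ) (cross : CrossIntersecting t 𝒜 ℬ)
         (t<n : t < n) (t≤r : t ≤ r) (t≤s : t ≤ s) where

  private
    cross′ : CrossIntersecting t ℬ 𝒜
    cross′ = CrossIntersecting-sym cross
    N Pᵣ Pₛ ρᵣ ρₛ : ℕ
    N  = n ∸ t
    Pᵣ = N C (r ∸ t)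
    Pₛ = N C (s ∸ t)
    ρᵣ = (n ∸ suc t) C[ r − suc t ]
    ρₛ = (n ∸ suc t) C[ s − suc t ]

  kernel∧¬kernel⇒< : (r ∸ t) * (r C t) * s < N → 0 < Pᵣ * Pₛ →
    {A S : Subset n} → 𝒜 A ≡ true → ∣ S ∣ ≡ t → Kernel S 𝒜 → ¬ Kernel S ℬ → card 𝒜 * card ℬ < Pᵣ * Pₛ
  kernel∧¬kernel⇒< bound 0<P {A} {S} 𝒜A ∣S∣≡t kernel ¬kernel = scaled<⇒< scaled bound 0<P
    where
    open ≤-Reasoning
    card-𝒜≤ : card 𝒜 ≤ s * ρᵣ
    card-𝒜≤ = subst (_≤ s * ρᵣ) (sym (card-cong (kernel⇒≐containing kernel)))
      (card-containing≤-¬kernel 𝒜-uniform ℬ-uniform cross S ∣S∣≡t ¬kernel)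
    card-ℬ≤ : card ℬ ≤ (r C t) * Pₛ
    card-ℬ≤ = card≤transversal-member ℬ-uniform 𝒜-uniform cross′ 𝒜A
      (λ S′ ∣S′∣≡t → card-containing≤ ℬ-uniform S′ ∣S′∣≡t t≤s)
    scaled : N * (card 𝒜 * card ℬ) ≤ ((r ∸ t) * (r C t) * s) * (Pᵣ * Pₛ)
    scaled = begin
      N * (card 𝒜 * card ℬ)               ≤⟨ *-monoʳ-≤ N (*-mono-≤ card-𝒜≤ card-ℬ≤) ⟩
      N * ((s * ρᵣ) * ((r C t) * Pₛ))
        ≡⟨ solve 5 (λ N s ρ c P → N :* ((s :* ρ) :* (c :* P)) := s :* c :* P :* (N :* ρ)) refl N s ρᵣ (r C t) Pₛ ⟩
      s * (r C t) * Pₛ * (N * ρᵣ)         ≡⟨ cong (s * (r C t) * Pₛ *_) (C[−]-absorb-∸ r t<n t≤r) ⟩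
      s * (r C t) * Pₛ * ((r ∸ t) * Pᵣ)
        ≡⟨ solve 5 (λ s c P a Q → s :* c :* P :* (a :* Q) := (a :* c :* s) :* (Q :* P)) refl s (r C t) Pₛ (r ∸ t) Pᵣ ⟩
      ((r ∸ t) * (r C t) * s) * (Pᵣ * Pₛ) ∎

  no-kernel⇒< : (r ∸ t) * (r C t) * s < N → (s ∸ t) * (s C t) * r < N → 0 < Pᵣ * Pₛ →
    {A B : Subset n} → 𝒜 A ≡ true → ℬ B ≡ true →
    (∀ S → ∣ S ∣ ≡ t → ¬ Kernel S 𝒜) → (∀ S → ∣ S ∣ ≡ t → ¬ Kernel S ℬ) → card 𝒜 * card ℬ < Pᵣ * Pₛ
  no-kernel⇒< bound-rs bound-sr 0<P 𝒜A ℬB no-kernel-𝒜 no-kernel-ℬ =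
    scaled<⇒< scaled (*-mono-< bound-rs bound-sr) 0<P
    where
    open ≤-Reasoning
    card-𝒜≤ : card 𝒜 ≤ (s C t) * (s * ρᵣ)
    card-𝒜≤ = card≤transversal-member 𝒜-uniform ℬ-uniform cross ℬB λ S ∣S∣≡t →
      card-containing≤-¬kernel 𝒜-uniform ℬ-uniform cross S ∣S∣≡t (no-kernel-ℬ S ∣S∣≡t)
    card-ℬ≤ : card ℬ ≤ (r C t) * (r * ρₛ)
    card-ℬ≤ = card≤transversal-member ℬ-uniform 𝒜-uniform cross′ 𝒜A λ S ∣S∣≡t →
      card-containing≤-¬kernel ℬ-uniform 𝒜-uniform cross′ S ∣S∣≡t (no-kernel-𝒜 S ∣S∣≡t)
    scaled : (N * N) * (card 𝒜 * card ℬ) ≤ (((r ∸ t) * (r C t) * s) * ((s ∸ t) * (s C t) * r)) * (Pᵣ * Pₛ)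
    scaled = begin
      (N * N) * (card 𝒜 * card ℬ)
        ≤⟨ *-monoʳ-≤ (N * N) (*-mono-≤ card-𝒜≤ card-ℬ≤) ⟩
      (N * N) * (((s C t) * (s * ρᵣ)) * ((r C t) * (r * ρₛ)))
        ≡⟨ solve 7 (λ N cs s ρ cr r σ → (N :* N) :* ((cs :* (s :* ρ)) :* (cr :* (r :* σ)))
                                     := cs :* s :* cr :* r :* (N :* ρ) :* (N :* σ))
             refl N (s C t) s ρᵣ (r C t) r ρₛ ⟩
      (s C t) * s * (r C t) * r * (N * ρᵣ) * (N * ρₛ)
        ≡⟨ cong₂ (λ x y → (s C t) * s * (r C t) * r * x * y) (C[−]-absorb-∸ r t<n t≤r) (C[−]-absorb-∸ s t<n t≤s) ⟩
      (s C t) * s * (r C t) * r * ((r ∸ t) * Pᵣ) * ((s ∸ t) * Pₛ)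
        ≡⟨ solve 8 (λ cs s cr r a P b Q → cs :* s :* cr :* r :* (a :* P) :* (b :* Q)
                                         := ((a :* cr :* s) :* (b :* cs :* r)) :* (P :* Q))
             refl (s C t) s (r C t) r (r ∸ t) Pᵣ (s ∸ t) Pₛ ⟩
      (((r ∸ t) * (r C t) * s) * ((s ∸ t) * (s C t) * r)) * (Pᵣ * Pₛ)
        ∎

common-kernel⊎< : ∀ {n r s t} {𝒜 ℬ : Family n} →
  IsUniform r 𝒜 → IsUniform s ℬ → CrossIntersecting t 𝒜 ℬ → t < n → t ≤ r → t ≤ s →
  (r ∸ t) * (r C t) * s < n ∸ t → (s ∸ t) * (s C t) * r < n ∸ t →
  0 < ((n ∸ t) C (r ∸ t)) * ((n ∸ t) C (s ∸ t)) →
  (∃[ T ] ∣ T ∣ ≡ t × Kernel T 𝒜 × Kernel T ℬ) ⊎ card 𝒜 * card ℬ < ((n ∸ t) C (r ∸ t)) * ((n ∸ t) C (s ∸ t))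
common-kernel⊎< {n} {r} {s} {t} {𝒜} {ℬ} 𝒜-uniform ℬ-uniform cross t<n t≤r t≤s bound-rs bound-sr 0<P
  with anySubset? (λ T → (∣ T ∣ ≟ t) ×-dec kernel? T 𝒜 ×-dec kernel? T ℬ)
... | yes common = inj₁ common
... | no  ∄common = inj₂ no-common-kernel⇒<
  where
  P : ℕ
  P = ((n ∸ t) C (r ∸ t)) * ((n ∸ t) C (s ∸ t))
  no-common : ∀ S → ∣ S ∣ ≡ t → Kernel S 𝒜 → ¬ Kernel S ℬ
  no-common S ∣S∣≡t kernel-𝒜 kernel-ℬ = ∄common (S , ∣S∣≡t , kernel-𝒜 , kernel-ℬ)
  no-common-kernel⇒< : card 𝒜 * card ℬ < P
  no-common-kernel⇒< with anySubset? (λ A → 𝒜 A Bool.≟ true) | anySubset? (λ B → ℬ B Bool.≟ true)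
  ... | no ∄A | _ = subst (_< P) (sym (cong (_* card ℬ) (card-∅ 𝒜 λ A 𝒜A → ∄A (A , 𝒜A)))) 0<P
  ... | yes _ | no ∄B =
    subst (_< P) (sym (trans (cong (card 𝒜 *_) (card-∅ ℬ λ B ℬB → ∄B (B , ℬB))) (*-zeroʳ (card 𝒜)))) 0<P
  ... | yes (A , 𝒜A) | yes (B , ℬB)
    with anySubset? (λ S → (∣ S ∣ ≟ t) ×-dec kernel? S 𝒜) | anySubset? (λ S → (∣ S ∣ ≟ t) ×-dec kernel? S ℬ)
  ... | yes (S , ∣S∣≡t , kernel) | _ =
    kernel∧¬kernel⇒< 𝒜-uniform ℬ-uniform cross t<n t≤r t≤s bound-rs 0<P 𝒜A ∣S∣≡t kernel
      (no-common S ∣S∣≡t kernel)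
  ... | no _ | yes (S , ∣S∣≡t , kernel) =
    subst₂ _<_ (*-comm (card ℬ) (card 𝒜)) (*-comm ((n ∸ t) C (s ∸ t)) ((n ∸ t) C (r ∸ t)))
      (kernel∧¬kernel⇒< ℬ-uniform 𝒜-uniform (CrossIntersecting-sym cross) t<n t≤s t≤r bound-sr
        (subst (0 <_) (*-comm ((n ∸ t) C (r ∸ t)) ((n ∸ t) C (s ∸ t))) 0<P) ℬB ∣S∣≡t kernel
        (λ kernel-𝒜 → no-common S ∣S∣≡t kernel-𝒜 kernel))
  ... | no ∄kernel-𝒜 | no ∄kernel-ℬ =
    no-kernel⇒< 𝒜-uniform ℬ-uniform cross t<n t≤r t≤s bound-rs bound-sr 0<P 𝒜A ℬB
      (λ S ∣S∣≡t kernel → ∄kernel-𝒜 (S , ∣S∣≡t , kernel)) (λ S ∣S∣≡t kernel → ∄kernel-ℬ (S , ∣S∣≡t , kernel))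

-- The threshold n₀

module Threshold {r s t n} (1≤t : 1 ≤ t) (t≤r : t ≤ r) (r≤s : r ≤ s) (n₀≤n : n₀ r s t ≤ n) where

  private
    M X′ Y′ : ℕ
    M  = r + s ∸ t
    X′ = (r * (s ∸ t)) * (M C t)
    Y′ = ((r ∸ t) * (r C t)) * (M C (t + 1))

    X′⊔Y′<n∸t : X′ ⊔ Y′ < n ∸ t
    X′⊔Y′<n∸t = m+n≤o⇒m≤o∸n (suc (X′ ⊔ Y′)) (subst (_≤ n) (+-comm (X′ ⊔ Y′ + t) 1) n₀≤n)

    M≡[r∸t]+s : M ≡ (r ∸ t) + s
    M≡[r∸t]+s = +-∸-comm s t≤r

    s≤M : s ≤ M
    s≤M = subst (s ≤_) (sym M≡[r∸t]+s) (m≤n+m s (r ∸ t))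

  t<n : t < n
  t<n = m∸n≢0⇒n<m λ n∸t≡0 → <⇒≢ (≤-<-trans z≤n X′⊔Y′<n∸t) (sym n∸t≡0)

  bound-sr : (s ∸ t) * (s C t) * r < n ∸ t
  bound-sr = ≤-<-trans (begin
    (s ∸ t) * (s C t) * r     ≡⟨ solve 3 (λ a c r → a :* c :* r := r :* a :* c) refl (s ∸ t) (s C t) r ⟩
    r * (s ∸ t) * (s C t)     ≤⟨ *-monoʳ-≤ (r * (s ∸ t)) (C-monoˡ-≤ t s≤M) ⟩
    X′                        ≤⟨ m≤m⊔n X′ Y′ ⟩
    X′ ⊔ Y′                   ∎) X′⊔Y′<n∸t
    where open ≤-Reasoning

  bound-rs : (r ∸ t) * (r C t) * s < n ∸ t
  bound-rs = ≤-<-trans (≤-trans bound≤Y′ (m≤n⊔m X′ Y′)) X′⊔Y′<n∸t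
    where
    bound≤Y′ : (r ∸ t) * (r C t) * s ≤ (r ∸ t) * (r C t) * (M C (t + 1))
    bound≤Y′ with t <? r
    ... | no  t≮r rewrite m≤n⇒m∸n≡0 (≮⇒≥ t≮r) = z≤n
    ... | yes t<r = *-monoʳ-≤ ((r ∸ t) * (r C t)) (begin
      s             ≤⟨ s≤M ⟩
      M             ≤⟨ n≤nCk (m≤n+m 1 t) t+1<M ⟩
      M C (t + 1)   ∎)
      where
      open ≤-Reasoning
      t+1≤s : t + 1 ≤ s
      t+1≤s = subst (_≤ s) (+-comm 1 t) (≤-trans t<r r≤s)
      t+1<M : t + 1 < M
      t+1<M = subst (t + 1 <_) (sym M≡[r∸t]+s) (+-mono-≤ (m<n⇒0<n∸m t<r) t+1≤s)

  s∸t≤n∸t : s ∸ t ≤ n ∸ t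
  s∸t≤n∸t = <⇒≤ (≤-<-trans (≤-trans (m≤m*n (s ∸ t) (s C t)) (m≤m*n ((s ∸ t) * (s C t)) r)) bound-sr)
    where
    instance
      sCt≢0 : NonZero (s C t)
      sCt≢0 = >-nonZero (k≤n⇒0<nCk (≤-trans t≤r r≤s))
      r≢0 : NonZero r
      r≢0 = >-nonZero (≤-trans 1≤t t≤r)

  0<[n∸t]C[r∸t] : 0 < (n ∸ t) C (r ∸ t)
  0<[n∸t]C[r∸t] = k≤n⇒0<nCk (≤-trans (∸-monoˡ-≤ t r≤s) s∸t≤n∸t)

  0<[n∸t]C[s∸t] : 0 < (n ∸ t) C (s ∸ t)
  0<[n∸t]C[s∸t] = k≤n⇒0<nCk s∸t≤n∸t

theorem1 : (r s t n : ℕ) → 1 ≤ t → t ≤ r → r ≤ s → n₀ r s t ≤ n →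
    (𝒜 ℬ : Family n) → IsUniform r 𝒜 → IsUniform s ℬ → CrossIntersecting t 𝒜 ℬ →
    (card 𝒜 * card ℬ ≤ ((n ∸ t) C (r ∸ t)) * ((n ∸ t) C (s ∸ t)))
    × ((card 𝒜 * card ℬ ≡ ((n ∸ t) C (r ∸ t)) * ((n ∸ t) C (s ∸ t)))
       ⇔ (∃[ T ] (∣ T ∣ ≡ t × 𝒜 ≐ star r T × ℬ ≐ star s T)))
theorem1 r s t n 1≤t t≤r r≤s n₀≤n 𝒜 ℬ 𝒜-uniform ℬ-uniform cross = card-bound , mk⇔ extremal stars-extremal
  where
  open Threshold 1≤t t≤r r≤s n₀≤n
  t≤s : t ≤ s
  t≤s = ≤-trans t≤r r≤s

  dichotomy : (∃[ T ] ∣ T ∣ ≡ t × Kernel T 𝒜 × Kernel T ℬ) ⊎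
              card 𝒜 * card ℬ < ((n ∸ t) C (r ∸ t)) * ((n ∸ t) C (s ∸ t))
  dichotomy = common-kernel⊎< 𝒜-uniform ℬ-uniform cross t<n t≤r t≤s bound-rs bound-sr
    (*-mono-< 0<[n∸t]C[r∸t] 0<[n∸t]C[s∸t])

  card-bound : card 𝒜 * card ℬ ≤ ((n ∸ t) C (r ∸ t)) * ((n ∸ t) C (s ∸ t))
  card-bound with dichotomy
  ... | inj₁ (T , ∣T∣≡t , kernel-𝒜 , kernel-ℬ) =
    common-kernel⇒card≤ 𝒜-uniform ℬ-uniform ∣T∣≡t t≤r t≤s kernel-𝒜 kernel-ℬ
  ... | inj₂ card< = <⇒≤ card<

  extremal : card 𝒜 * card ℬ ≡ ((n ∸ t) C (r ∸ t)) * ((n ∸ t) C (s ∸ t)) →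
             ∃[ T ] ∣ T ∣ ≡ t × 𝒜 ≐ star r T × ℬ ≐ star s T
  extremal card≡ with dichotomy
  ... | inj₁ (T , ∣T∣≡t , kernel-𝒜 , kernel-ℬ) = T , ∣T∣≡t , common-kernel∧card≡⇒≐stars 𝒜-uniform ℬ-uniform
    ∣T∣≡t t≤r t≤s kernel-𝒜 kernel-ℬ 0<[n∸t]C[r∸t] 0<[n∸t]C[s∸t] card≡
  ... | inj₂ card< = ⊥-elim (<-irrefl card≡ card<)

  stars-extremal : (∃[ T ] ∣ T ∣ ≡ t × 𝒜 ≐ star r T × ℬ ≐ star s T) →
                   card 𝒜 * card ℬ ≡ ((n ∸ t) C (r ∸ t)) * ((n ∸ t) C (s ∸ t))
  stars-extremal (T , ∣T∣≡t , 𝒜≐star , ℬ≐star) =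
    cong₂ _*_ (trans (card-cong 𝒜≐star) (card-star≡ r T ∣T∣≡t t≤r))
              (trans (card-cong ℬ≐star) (card-star≡ s T ∣T∣≡t t≤s))
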